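{- Let $G$ be a finite graph in which every vertex has even degree, and consider the bridge-burning game on $G$. If at some point during the game some cop occupies the robber's starting vertex, then the cops can capture the robber.
   Context: Bridge-burning Cops and Robbers is played on a finite graph $G$ by a team of cops and a single robber, with full information. First each cop chooses a starting vertex (several cops may share a vertex), then the robber chooses a starting vertex. The game then proceeds in rounds; in each round, first every cop either stays put or moves along an edge of the current graph to an adjacent vertex, and then the robber either stays put or moves along an edge of the current graph. Every edge traversed by the robber is immediately deleted from the graph (cop moves delete nothing). The cops win if at some moment some cop occupies the same vertex as the robber; the robber wins if he avoids this forever. -}

module Defs where

open import Data.Nat using (ℕ; zero; suc; _+_)
open import Data.Nat.Divisibility using (_∣_)
open import Data.Fin using (Fin; _≟_)
open import Data.Bool using (Bool; true; false; if_then_else_; _∧_; _∨_)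
open import Data.List using (List; map; allFin)
open import Data.Nat.ListAction using (sum)
open import Data.Sum using (_⊎_)
open import Data.Product using (∃; _,_)
open import Relation.Nullary.Decidable using (⌊_⌋)
open import Relation.Binary.PropositionalEquality using (_≡_)

Adj : ℕ → Set
Adj n = Fin n → Fin n → Bool

record SimpleGraph (n : ℕ) : Set where
  field
    adj    : Adj n
    sym    : ∀ u v → adj u v ≡ adj v u
    irrefl : ∀ v → adj v v ≡ false
open SimpleGraph public

degree : ∀ {n} → Adj n → Fin n → ℕ
degree {n} E v = sum (map (λ w → if E v w then 1 else 0) (allFin n))

burn : ∀ {n} → Adj n → Fin n → Fin n → Adj n
burn E u v x y =
  if (⌊ x ≟ u ⌋ ∧ ⌊ y ≟ v ⌋) ∨ (⌊ x ≟ v ⌋ ∧ ⌊ y ≟ u ⌋) then false else E x y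

data Turn : Set where
  copsTurn robberTurn : Turn

record Pos (n k : ℕ) : Set where
  constructor pos
  field
    graph  : Adj n
    cops   : Fin k → Fin n
    robber : Fin n
    turn   : Turn
open Pos public

CopMove : ∀ {n k} → Adj n → (Fin k → Fin n) → (Fin k → Fin n) → Set
CopMove E c c' = ∀ i → (c' i ≡ c i) ⊎ (E (c i) (c' i) ≡ true)

data RobberMove {n} (E : Adj n) (r : Fin n) : Adj n → Fin n → Set where
  stay : RobberMove E r E r
  go   : ∀ w → E r w ≡ true → RobberMove E r (burn E r w) w

data Move {n k} : Pos n k → Pos n k → Set where
  copStep : ∀ {E c c' r} → CopMove E c c' →
            Move (pos E c r copsTurn) (pos E c' r robberTurn)
  robStep : ∀ {E E' c r r'} → RobberMove E r E' r' →
            Move (pos E c r robberTurn) (pos E' c r' copsTurn)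

Captured : ∀ {n k} → Pos n k → Set
Captured p = ∃ λ i → cops p i ≡ robber p

data CopsWin {n k} : Pos n k → Set where
  caught    : ∀ {p} → Captured p → CopsWin p
  copsMove  : ∀ {p q} → Move p q → turn p ≡ copsTurn → CopsWin q → CopsWin p
  robberAll : ∀ {p} → turn p ≡ robberTurn →
              (∀ q → Move p q → CopsWin q) → CopsWin p

-- Positions arising during a play of the game on G in which the robber
-- started at r0 (cops choose any start c, then robber picks r0).
data Reachable {n k} (G : SimpleGraph n) (r0 : Fin n) : Pos n k → Set where
  start : ∀ c → Reachable G r0 (pos (adj G) c r0 copsTurn)
  next  : ∀ {p q} → Reachable G r0 p → Move p q → Reachable G r0 q

module Submission where

-- Parity invariant: burning the edge ab flips the degree parity of exactly a
-- and b, so when the robber has walked from r0 to ρ the odd-degree vertices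
-- are {r0} ⊕ {ρ}.  Hence the current graph always has a walk from ρ to r0.
--
-- Guarding: a cop on c guards if every walk from the robber to r0 passes c
-- (a cop on r0 guards).  The guard advances along a shortest walk towards the
-- robber while he stays put; once he burns an edge, the cop walks straight
-- back to c.  Minimality keeps the robber strictly farther from c than the
-- cop, so the way back is never burned, and on c the cop guards again in a
-- graph with fewer edges.  Induction on the number of edges ends the game.

open import Defs hiding (sym)
open import Data.Nat using (ℕ; zero; suc; _+_; _*_; _≤_; _<_; z≤n; s≤s)
open import Data.Nat.Properties
  using (+-0-monoid; +-suc; +-mono-≤; +-mono-<-≤; +-mono-≤-<; ≤-refl; ≤-reflexive; ≤-trans; ≤-pred;
         <-trans; <⇒≱; ≰⇒>; n≤1+n; m≤m+n; m≤n⇒m<n∨m≡n)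
open import Data.Nat.Divisibility using (_∣_; divides)
open import Data.Nat.Induction using (<-wellFounded)
open import Data.Nat.ListAction using () renaming (sum to sumList)
open import Data.Fin using (Fin; zero; suc; _≟_)
open import Data.Fin.Properties using (any?; suc-injective)
open import Data.Bool using (Bool; true; false; not; _∧_; _∨_; _xor_; if_then_else_)
open import Data.Bool.Properties
  using (not-involutive; ∧-comm; ∨-comm; xor-comm; xor-assoc; xor-same; xor-identityʳ)
  renaming (_≟_ to _≟ᴮ_)
open import Data.List using (tabulate) renaming (map to mapList)
open import Data.Product using (∃; _,_; _×_; proj₁; proj₂)
open import Data.Sum using (_⊎_; inj₁; inj₂)
open import Data.Empty using (⊥-elim)
open import Data.Vec.Functional using (updateAt)
open import Data.Vec.Functional.Properties using (updateAt-updates; updateAt-minimal)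
open import Algebra.Properties.Monoid.Sum +-0-monoid using (sum; sum-cong-≗; sum-replicate-zero)
open import Induction.WellFounded using (Acc; acc)
open import Relation.Nullary using (¬_; Dec; yes; no)
open import Relation.Nullary.Decidable using (⌊_⌋; isYes≗does; dec-true; dec-false; _×-dec_)
open import Relation.Binary.PropositionalEquality
  using (_≡_; _≢_; refl; sym; trans; cong; cong₂; subst; module ≡-Reasoning)
open import Function using (_∘_; id; const)

sum-tabulate : ∀ {m p} (f : Fin p → ℕ) (g : Fin m → Fin p) →
               sumList (mapList f (tabulate g)) ≡ sum (f ∘ g)
sum-tabulate {zero}  f g = refl
sum-tabulate {suc m} f g = cong (f (g zero) +_) (sum-tabulate f (g ∘ suc))

sum-mono-≤ : ∀ {m} {f g : Fin m → ℕ} → (∀ x → f x ≤ g x) → sum f ≤ sum g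
sum-mono-≤ {zero}  le = z≤n
sum-mono-≤ {suc m} le = +-mono-≤ (le zero) (sum-mono-≤ (le ∘ suc))

sum-mono-< : ∀ {m} {f g : Fin m → ℕ} → (∀ x → f x ≤ g x) → ∀ y → f y < g y → sum f < sum g
sum-mono-< {suc m} le zero    lt = +-mono-<-≤ lt (sum-mono-≤ (le ∘ suc))
sum-mono-< {suc m} le (suc y) lt = +-mono-≤-< (le zero) (sum-mono-< (le ∘ suc) y lt)

sum-bump : ∀ {m} {f g : Fin m → ℕ} y → (∀ x → x ≢ y → f x ≡ g x) → f y ≡ suc (g y) →
           sum f ≡ suc (sum g)
sum-bump {suc m} zero same hit = cong₂ _+_ hit (sum-cong-≗ (λ x → same (suc x) λ ()))
sum-bump {suc m} {f} {g} (suc y) same hit =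
  trans (cong₂ _+_ (same zero λ ()) (sum-bump y (λ x x≢y → same (suc x) (x≢y ∘ suc-injective)) hit))
        (+-suc (g zero) (sum (g ∘ suc)))

isOdd : ℕ → Bool
isOdd zero    = false
isOdd (suc m) = not (isOdd m)

isOdd-even : ∀ {m} → 2 ∣ m → isOdd m ≡ false
isOdd-even (divides q refl) = isOdd-double q
  where
    isOdd-double : ∀ q → isOdd (q * 2) ≡ false
    isOdd-double zero    = refl
    isOdd-double (suc q) = trans (not-involutive _) (isOdd-double q)

isOdd-pred : ∀ {m m'} → m ≡ suc m' → isOdd m' ≡ isOdd m xor true
isOdd-pred {m' = m'} refl = sym (trans (xor-comm (not (isOdd m')) true) (not-involutive (isOdd m')))

xor-cancel-middle : ∀ x y z → (x xor y) xor (y xor z) ≡ x xor z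
xor-cancel-middle x y z = begin
  (x xor y) xor (y xor z) ≡⟨ xor-assoc x y (y xor z) ⟩
  x xor (y xor (y xor z)) ≡⟨ cong (x xor_) (sym (xor-assoc y y z)) ⟩
  x xor ((y xor y) xor z) ≡⟨ cong (λ b → x xor (b xor z)) (xor-same y) ⟩
  x xor z                 ∎
  where open ≡-Reasoning

⌊⌋-true : ∀ {P : Set} (p? : Dec P) → P → ⌊ p? ⌋ ≡ true
⌊⌋-true p? p = trans (isYes≗does p?) (dec-true p? p)

⌊⌋-false : ∀ {P : Set} (p? : Dec P) → ¬ P → ⌊ p? ⌋ ≡ false
⌊⌋-false p? ¬p = trans (isYes≗does p?) (dec-false p? ¬p)

⌊⌋-∧-false : ∀ {P Q : Set} (p? : Dec P) (q? : Dec Q) → ¬ (P × Q) → (⌊ p? ⌋ ∧ ⌊ q? ⌋) ≡ false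
⌊⌋-∧-false (yes p) (yes q) ¬pq = ⊥-elim (¬pq (p , q))
⌊⌋-∧-false (yes p) (no ¬q) ¬pq = refl
⌊⌋-∧-false (no ¬p) q?      ¬pq = refl

Sym : ∀ {n} → Adj n → Set
Sym E = ∀ x y → E x y ≡ E y x

Loopless : ∀ {n} → Adj n → Set
Loopless E = ∀ x → E x x ≡ false

Subgraph : ∀ {n} → Adj n → Adj n → Set
Subgraph E E' = ∀ {x y} → E x y ≡ true → E' x y ≡ true

χ : Bool → ℕ
χ b = if b then 1 else 0

deg : ∀ {n} → Adj n → Fin n → ℕ
deg E v = sum (λ w → χ (E v w))

-- Sum of all degrees: twice the number of edges, the termination measure.
size : ∀ {n} → Adj n → ℕ
size E = sum (deg E)

degree≡deg : ∀ {n} (E : Adj n) v → degree E v ≡ deg E v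
degree≡deg E v = sum-tabulate (λ w → χ (E v w)) id

edge-≢ : ∀ {n} {E : Adj n} → Loopless E → ∀ {a b} → E a b ≡ true → a ≢ b
edge-≢ {E = E} loopless {a} e refl with trans (sym e) (loopless a)
... | ()

subgraph-loopless : ∀ {n} {E E' : Adj n} → Subgraph E E' → Loopless E' → Loopless E
subgraph-loopless {E = E} sub loopless x with E x x in e
... | false = refl
... | true  = trans (sym (sub e)) (loopless x)

burn-sub : ∀ {n} (E : Adj n) a b → Subgraph (burn E a b) E
burn-sub E a b {x} {y} with (⌊ x ≟ a ⌋ ∧ ⌊ y ≟ b ⌋) ∨ (⌊ x ≟ b ⌋ ∧ ⌊ y ≟ a ⌋)
... | true  = λ ()
... | false = id

module _ {n : ℕ} {E : Adj n} where

  burn-away : ∀ {a b x y} → ¬ (x ≡ a × y ≡ b) → ¬ (x ≡ b × y ≡ a) → burn E a b x y ≡ E x y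
  burn-away {a} {b} {x} {y} not-ab not-ba =
    cong₂ (λ p q → if p ∨ q then false else E x y)
          (⌊⌋-∧-false (x ≟ a) (y ≟ b) not-ab) (⌊⌋-∧-false (x ≟ b) (y ≟ a) not-ba)

  burn-hit : ∀ {a b} → burn E a b a b ≡ false
  burn-hit {a} {b} = cong (λ p → if p ∨ (⌊ a ≟ b ⌋ ∧ ⌊ b ≟ a ⌋) then false else E a b)
                          (cong₂ _∧_ (⌊⌋-true (a ≟ a) refl) (⌊⌋-true (b ≟ b) refl))

  burn-swap : ∀ {a b} x y → burn E a b x y ≡ burn E b a x y
  burn-swap {a} {b} x y = cong (λ p → if p then false else E x y) (∨-comm (⌊ x ≟ a ⌋ ∧ ⌊ y ≟ b ⌋) _)

  burn-sym : ∀ {a b} → Sym E → Sym (burn E a b)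
  burn-sym {a} {b} sym-E x y = cong₂ (λ p e → if p then false else e) same-pair (sym-E x y)
    where
      same-pair : ((⌊ x ≟ a ⌋ ∧ ⌊ y ≟ b ⌋) ∨ (⌊ x ≟ b ⌋ ∧ ⌊ y ≟ a ⌋))
                ≡ ((⌊ y ≟ a ⌋ ∧ ⌊ x ≟ b ⌋) ∨ (⌊ y ≟ b ⌋ ∧ ⌊ x ≟ a ⌋))
      same-pair = trans (cong₂ _∨_ (∧-comm ⌊ x ≟ a ⌋ _) (∧-comm ⌊ x ≟ b ⌋ _))
                        (∨-comm (⌊ y ≟ b ⌋ ∧ ⌊ x ≟ a ⌋) _)

  deg-burn-endpoint : ∀ {a b} → E a b ≡ true → a ≢ b → deg E a ≡ suc (deg (burn E a b) a)
  deg-burn-endpoint {a} {b} e a≢b =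
    sum-bump b (λ w w≢b → cong χ (sym (burn-away {x = a} {y = w} (w≢b ∘ proj₂) (a≢b ∘ proj₁))))
               (trans (cong χ e) (cong (suc ∘ χ) (sym burn-hit)))

  deg-burn-≤ : ∀ {a b} x → deg (burn E a b) x ≤ deg E x
  deg-burn-≤ {a} {b} x = sum-mono-≤ λ y → χ-mono (burn E a b x y) (burn-sub E a b)
    where
      χ-mono : ∀ p {q} → (p ≡ true → q ≡ true) → χ p ≤ χ q
      χ-mono false imp = z≤n
      χ-mono true  imp rewrite imp refl = ≤-refl

  size-burn : ∀ {a b} → E a b ≡ true → a ≢ b → size (burn E a b) < size E
  size-burn {a} e a≢b = sum-mono-< deg-burn-≤ a (≤-reflexive (sym (deg-burn-endpoint e a≢b)))

  parity-burn : ∀ {a b} → Sym E → E a b ≡ true → a ≢ b →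
                ∀ v → isOdd (deg (burn E a b) v) ≡ isOdd (deg E v) xor (⌊ v ≟ a ⌋ xor ⌊ v ≟ b ⌋)
  parity-burn {a} {b} sym-E e a≢b v = flips (v ≟ a) (v ≟ b)
    where
      flips : (v≟a : Dec (v ≡ a)) (v≟b : Dec (v ≡ b)) →
              isOdd (deg (burn E a b) v) ≡ isOdd (deg E v) xor (⌊ v≟a ⌋ xor ⌊ v≟b ⌋)
      flips (yes refl) (yes refl) = ⊥-elim (a≢b refl)
      flips (yes refl) (no _)     = isOdd-pred (deg-burn-endpoint e a≢b)
      flips (no v≢a)   (yes refl) = isOdd-pred deg-b
        where
          deg-b : deg E b ≡ suc (deg (burn E a b) b)
          deg-b = trans (deg-burn-endpoint {a = b} {b = a} (trans (sym-E b a) e) (a≢b ∘ sym))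
                        (cong suc (sum-cong-≗ (λ w → cong χ (sym (burn-swap b w)))))
      flips (no v≢a)   (no v≢b)   =
        trans (cong isOdd (sum-cong-≗ (λ w → cong χ (burn-away {x = v} {y = w} (v≢a ∘ proj₁) (v≢b ∘ proj₁)))))
              (sym (xor-identityʳ _))

neighbour : ∀ {n} (E : Adj n) v → isOdd (deg E v) ≡ true → ∃ λ u → E v u ≡ true
neighbour {n} E v odd with any? (λ u → E v u ≟ᴮ true)
... | yes found = found
... | no none with trans (sym odd) (cong isOdd isolated)
  where
    no-edge : ∀ u → χ (E v u) ≡ 0
    no-edge u with E v u in e
    ... | true  = ⊥-elim (none (u , e))
    ... | false = refl
    isolated : deg E v ≡ 0
    isolated = trans (sum-cong-≗ no-edge) (sum-replicate-zero n)
... | ()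

data Walk {n} (E : Adj n) : Fin n → Fin n → ℕ → Set where
  []  : ∀ {u} → Walk E u u 0
  _∷_ : ∀ {u x v L} → E u x ≡ true → Walk E x v L → Walk E u v (suc L)

mono : ∀ {n} {E E' : Adj n} → Subgraph E E' → ∀ {u v L} → Walk E u v L → Walk E' u v L
mono sub []      = []
mono sub (e ∷ W) = sub e ∷ mono sub W

module _ {n : ℕ} {E : Adj n} where

  _∷ʳ_ : ∀ {u x v L} → Walk E u x L → E x v ≡ true → Walk E u v (suc L)
  []      ∷ʳ e' = e' ∷ []
  (e ∷ W) ∷ʳ e' = e ∷ (W ∷ʳ e')

  reverse : Sym E → ∀ {u v L} → Walk E u v L → Walk E v u L
  reverse sym-E []            = []
  reverse sym-E (_∷_ {u} {x} e W) = reverse sym-E W ∷ʳ trans (sym-E x u) e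

  -- Existence of a walk of a given length is decidable, so shortest walks exist.
  walk? : ∀ u v L → Dec (Walk E u v L)
  walk? u v zero with u ≟ v
  ... | yes refl = yes []
  ... | no u≢v   = no λ { [] → u≢v refl }
  walk? u v (suc L) with any? (λ x → (E u x ≟ᴮ true) ×-dec walk? x v L)
  ... | yes (x , e , W) = yes (e ∷ W)
  ... | no none         = no λ { (e ∷ W) → none (_ , e , W) }

  Avoids : Fin n → ∀ {u v L} → Walk E u v L → Set
  Avoids z {u} []      = u ≢ z
  Avoids z {u} (e ∷ W) = u ≢ z × Avoids z W

  avoids-start : ∀ {z u v L} (W : Walk E u v L) → Avoids z W → u ≢ z
  avoids-start []      u≢z        = u≢z
  avoids-start (e ∷ W) (u≢z , _) = u≢z

  avoids-end : ∀ {z u v L} (W : Walk E u v L) → Avoids z W → v ≢ z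
  avoids-end []      v≢z      = v≢z
  avoids-end (e ∷ W) (_ , av) = avoids-end W av

  prefix-to : ∀ {z u v L} (W : Walk E u v L) → ¬ Avoids z W → ∃ λ ℓ → Walk E u z ℓ
  prefix-to {z} {u} W visits with u ≟ z
  ... | yes refl = 0 , []
  prefix-to []      visits | no u≢z = ⊥-elim (visits u≢z)
  prefix-to (e ∷ W) visits | no u≢z with prefix-to W (λ av → visits (u≢z , av))
  ... | ℓ , P = suc ℓ , e ∷ P

  survive : ∀ {ρ w u v L} (W : Walk E u v L) → Avoids ρ W → Walk (burn E ρ w) u v L
  survive []      _          = []
  survive {ρ} {w} (_∷_ {u} {x} e W) (u≢ρ , av) =
    trans (burn-away {E = E} {a = ρ} {b = w} {x = u} {y = x} (u≢ρ ∘ proj₁) (avoids-start W av ∘ proj₂)) e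
    ∷ survive W av

avoids-mono : ∀ {n} {E E' : Adj n} (sub : Subgraph E E') {z u v L} (W : Walk E u v L) →
              Avoids z W → Avoids z (mono sub W)
avoids-mono sub []      av         = av
avoids-mono sub (e ∷ W) (u≢z , av) = u≢z , avoids-mono sub W av

least : {P : ℕ → Set} → (∀ j → Dec (P j)) → ∀ {L} → P L → ∃ λ d → P d × (∀ j → P j → d ≤ j)
least {P} P? {L} pL with scan L
  where
    scan : ∀ L → (∃ λ d → P d × (∀ j → P j → d ≤ j)) ⊎ (∀ j → j ≤ L → ¬ P j)
    scan zero with P? 0
    ... | yes p0 = inj₁ (0 , p0 , λ _ _ → z≤n)
    ... | no ¬p0 = inj₂ λ { .0 z≤n → ¬p0 }
    scan (suc L) with scan L
    ... | inj₁ found = inj₁ found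
    ... | inj₂ none with P? (suc L)
    ...   | yes p = inj₁ (suc L , p , λ j pj → ≰⇒> (λ j≤L → none j j≤L pj))
    ...   | no ¬p = inj₂ λ j j≤ → below j (m≤n⇒m<n∨m≡n j≤)
      where
        below : ∀ j → j < suc L ⊎ j ≡ suc L → ¬ P j
        below j (inj₁ j<) = none j (≤-pred j<)
        below j (inj₂ refl) = ¬p
... | inj₁ found = found
... | inj₂ none  = ⊥-elim (none L ≤-refl pL)

Far : ∀ {n} → Adj n → Fin n → Fin n → ℕ → Set
Far E ρ c g = ∀ {ℓ} → Walk E ρ c ℓ → g ≤ ℓ

module _ {n : ℕ} {E : Adj n} {ρ c : Fin n} where

  shortest : ∀ {L} → Walk E ρ c L → ∃ λ d → Walk E ρ c d × Far E ρ c d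
  shortest W with least (walk? ρ c) W
  ... | d , Q , minimal = d , Q , λ {ℓ} W' → minimal ℓ W'

  far-mono : ∀ {g g'} → g' ≤ g → Far E ρ c g → Far E ρ c g'
  far-mono g'≤g far W = ≤-trans g'≤g (far W)

  far-≢ : ∀ {g} → Far E ρ c (suc g) → ρ ≢ c
  far-≢ far refl with far []
  ... | ()

  far-avoids : ∀ {g x L} → Far E ρ c g → (P : Walk E x c L) → L < g → Avoids ρ P
  far-avoids far []      lt = λ { refl → <⇒≱ lt (far []) }
  far-avoids far (e ∷ P) lt = (λ { refl → <⇒≱ lt (far (e ∷ P)) }) , far-avoids far P (<-trans (s≤s ≤-refl) lt)

  far-burn : ∀ {g w} → E ρ w ≡ true → Far E ρ c (suc g) → Far (burn E ρ w) w c g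
  far-burn {w = w} e far W = ≤-pred (far (e ∷ mono (burn-sub E ρ w) W))

module Strategy {n k : ℕ} (r0 : Fin n) (i0 : Fin k) where

  record Arena (E : Adj n) (ρ : Fin n) : Set where
    field
      symmetric : Sym E
      loopless  : Loopless E
      oddDegree : ∀ v → isOdd (deg E v) ≡ ⌊ v ≟ r0 ⌋ xor ⌊ v ≟ ρ ⌋
  open Arena

  arena-burn : ∀ {E ρ w} → Arena E ρ → E ρ w ≡ true → Arena (burn E ρ w) w
  arena-burn {E} {ρ} {w} A e = record
    { symmetric = burn-sym (symmetric A)
    ; loopless  = subgraph-loopless {E = burn E ρ w} (burn-sub E ρ w) (loopless A)
    ; oddDegree = odd
    }
    where
      odd : ∀ v → isOdd (deg (burn E ρ w) v) ≡ ⌊ v ≟ r0 ⌋ xor ⌊ v ≟ w ⌋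
      odd v = begin
        isOdd (deg (burn E ρ w) v)                           ≡⟨ parity-burn (symmetric A) e (edge-≢ (loopless A) e) v ⟩
        isOdd (deg E v) xor (⌊ v ≟ ρ ⌋ xor ⌊ v ≟ w ⌋)           ≡⟨ cong (_xor _) (oddDegree A v) ⟩
        (⌊ v ≟ r0 ⌋ xor ⌊ v ≟ ρ ⌋) xor (⌊ v ≟ ρ ⌋ xor ⌊ v ≟ w ⌋) ≡⟨ xor-cancel-middle ⌊ v ≟ r0 ⌋ _ _ ⟩
        ⌊ v ≟ r0 ⌋ xor ⌊ v ≟ w ⌋                              ∎
        where open ≡-Reasoning

  -- The robber can always walk back to r0: away from r0 his vertex has odd
  -- degree, so leave along an edge, burn it, and recurse.
  connect : ∀ E ρ → Acc _<_ (size E) → Arena E ρ → ∃ λ L → Walk E ρ r0 L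
  connect E ρ (acc smaller) A with ρ ≟ r0
  ... | yes refl = 0 , []
  ... | no ρ≢r0 with neighbour E ρ odd
    where
      odd : isOdd (deg E ρ) ≡ true
      odd = trans (oddDegree A ρ) (cong₂ _xor_ (⌊⌋-false (ρ ≟ r0) ρ≢r0) (⌊⌋-true (ρ ≟ ρ) refl))
  ... | u , e with connect (burn E ρ u) u (smaller (size-burn e (edge-≢ (loopless A) e))) (arena-burn A e)
  ... | L , W = suc L , e ∷ mono (burn-sub E ρ u) W

  Guards : Adj n → Fin n → Fin n → Set
  Guards E c ρ = ∀ {L} (W : Walk E ρ r0 L) → ¬ Avoids c W

  guards-r0 : ∀ {E ρ} → Guards E r0 ρ
  guards-r0 W av = avoids-end W av refl

  guards-burn : ∀ {E c ρ w} → E ρ w ≡ true → ρ ≢ c → Guards E c ρ → Guards (burn E ρ w) c w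
  guards-burn {E} {ρ = ρ} {w} e ρ≢c guards W av =
    guards (e ∷ mono (burn-sub E ρ w) W) (ρ≢c , avoids-mono (burn-sub E ρ w) W av)

  send : (Fin k → Fin n) → Fin n → Fin k → Fin n
  send cs x = updateAt cs i0 (const x)

  sent : ∀ cs x → send cs x i0 ≡ x
  sent cs x = updateAt-updates i0 cs

  copMove : ∀ {E cs ρ x} → E (cs i0) x ≡ true →
            CopsWin (pos E (send cs x) ρ robberTurn) → CopsWin (pos E cs ρ copsTurn)
  copMove {E} {cs} {ρ} {x} e = copsMove (copStep legal) refl
    where
      legal : CopMove E cs (send cs x)
      legal i with i ≟ i0
      ... | yes refl = inj₂ (subst (λ y → E (cs i0) y ≡ true) (sym (sent cs x)) e)
      ... | no i≢i0  = inj₁ (updateAt-minimal i i0 cs i≢i0)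

  robberReplies : ∀ {E : Adj n} {cs : Fin k → Fin n} {ρ} → CopsWin (pos E cs ρ copsTurn) →
                  (∀ w → E ρ w ≡ true → CopsWin (pos (burn E ρ w) cs w copsTurn)) →
                  CopsWin (pos E cs ρ robberTurn)
  robberReplies ifStays ifMoves = robberAll refl λ
    { _ (robStep stay)       → ifStays
    ; _ (robStep (go w e)) → ifMoves w e }

  GuardIH : Adj n → Set
  GuardIH E = ∀ E' cs ρ → size E' < size E → Arena E' ρ → Guards E' (cs i0) ρ →
              CopsWin (pos E' cs ρ copsTurn)

  -- Return to the guard vertex c along P, in a graph E' smaller than E.  The
  -- robber stays farther from c than the cop, so P never meets him.
  module Retreat (E : Adj n) (c : Fin n) (IH : GuardIH E) where

    retreat : ∀ {E' ρ x g} cs → cs i0 ≡ x → Walk E' x c g → Far E' ρ c g → Guards E' c ρ →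
              Arena E' ρ → size E' < size E → CopsWin (pos E' cs ρ copsTurn)
    retreat {E'} {ρ} cs at [] far guards A shrunk =
      IH E' cs ρ shrunk A (subst (λ z → Guards E' z ρ) (sym at) guards)
    retreat {E'} {ρ} cs at (_∷_ {x = x'} e P) far guards A shrunk =
      copMove (subst (λ z → E' z x' ≡ true) (sym at) e) (robberReplies ifStays ifMoves)
      where
        ifStays : CopsWin (pos E' (send cs x') ρ copsTurn)
        ifStays = retreat (send cs x') (sent cs x') P (far-mono (n≤1+n _) far) guards A shrunk
        ifMoves : ∀ w → E' ρ w ≡ true → CopsWin (pos (burn E' ρ w) (send cs x') w copsTurn)
        ifMoves w e' =
          retreat (send cs x') (sent cs x') (survive P (far-avoids far P ≤-refl)) (far-burn e' far)
                  (guards-burn e' (far-≢ far) guards) (arena-burn A e')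
                  (<-trans (size-burn e' (edge-≢ (loopless A) e')) shrunk)

  -- Advance from the guard vertex c towards the robber at ρ along a shortest
  -- walk: 'back' leads back to c, 'fwd' on to ρ, and j + f is ρ's distance to c.
  module Advance (E : Adj n) (ρ c : Fin n) (A : Arena E ρ) (guards : Guards E c ρ) (IH : GuardIH E) where

    mutual
      advance : ∀ {x j f} cs → cs i0 ≡ x → Walk E x c j → Walk E x ρ f → Far E ρ c (j + f) →
                CopsWin (pos E cs ρ copsTurn)
      advance cs at back [] far = caught (i0 , at)
      advance {x} {j} cs at back (_∷_ {x = x'} {L = f} e fwd) far =
        copMove (subst (λ z → E z x' ≡ true) (sym at) e)
                (respond (send cs x') (sent cs x') (trans (symmetric A x' x) e ∷ back) fwd
                         (subst (Far E ρ c) (+-suc j f) far))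

      -- The robber's reply while the cop is on its way: if he stays the cop
      -- keeps advancing, if he burns an edge the cop retreats along 'back'.
      respond : ∀ {x j f} cs → cs i0 ≡ x → Walk E x c j → Walk E x ρ f → Far E ρ c (j + f) →
                CopsWin (pos E cs ρ robberTurn)
      respond cs at back [] far = caught (i0 , at)
      respond {j = j} cs at back fwd@(_∷_ {L = f} _ _) far = robberReplies (advance cs at back fwd far) ifMoves
        where
          nearer : Far E ρ c (suc j)
          nearer = far-mono (≤-trans (s≤s (m≤m+n j f)) (≤-reflexive (sym (+-suc j f)))) far
          ifMoves : ∀ w → E ρ w ≡ true → CopsWin (pos (burn E ρ w) cs w copsTurn)
          ifMoves w e =
            Retreat.retreat E c IH cs at (survive back (far-avoids nearer back ≤-refl)) (far-burn e nearer)
                            (guards-burn e (far-≢ nearer) guards) (arena-burn A e)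
                            (size-burn e (edge-≢ (loopless A) e))

  guard : ∀ E → Acc _<_ (size E) → ∀ cs ρ → Arena E ρ → Guards E (cs i0) ρ →
          CopsWin (pos E cs ρ copsTurn)
  guard E (acc smaller) cs ρ A guards
    with connect E ρ (acc smaller) A
  ... | _ , home with prefix-to home (guards home)
  ... | _ , toGuard with shortest toGuard
  ... | _ , Q , far = Advance.advance E ρ (cs i0) A guards IH cs refl [] (reverse (symmetric A) Q) far
    where
      IH : GuardIH E
      IH E' cs' ρ' shrunk = guard E' (smaller shrunk) cs' ρ'

  reachable-arena : ∀ (G : SimpleGraph n) → (∀ v → 2 ∣ degree (adj G) v) →
                    ∀ {p : Pos n k} → Reachable G r0 p → Arena (graph p) (robber p)
  reachable-arena G even (start _) = record
    { symmetric = SimpleGraph.sym G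
    ; loopless  = irrefl G
    ; oddDegree = λ v → trans (trans (cong isOdd (sym (degree≡deg (adj G) v))) (isOdd-even (even v)))
                              (sym (xor-same ⌊ v ≟ r0 ⌋))
    }
  reachable-arena G even (next rp (copStep _))         = reachable-arena G even rp
  reachable-arena G even (next rp (robStep stay))      = reachable-arena G even rp
  reachable-arena G even (next rp (robStep (go w e))) = arena-burn (reachable-arena G even rp) e

  win : ∀ (G : SimpleGraph n) → (∀ v → 2 ∣ degree (adj G) v) →
        ∀ (p : Pos n k) → Reachable G r0 p → cops p i0 ≡ r0 → CopsWin p
  win G even (pos E cs ρ copsTurn) rp on-r0 =
    guard E (<-wellFounded (size E)) cs ρ (reachable-arena G even rp)
          (subst (λ z → Guards E z ρ) (sym on-r0) guards-r0)
  win G even (pos E cs ρ robberTurn) rp on-r0 =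
    robberAll refl λ { q (robStep m) → win G even q (next rp (robStep m)) on-r0 }

lemma4p4 : ∀ {n k} (G : SimpleGraph n) →
    (∀ v → 2 ∣ degree (adj G) v) →
    ∀ (r0 : Fin n) (p : Pos n k) → Reachable G r0 p →
    (∃ λ i → cops p i ≡ r0) →
    CopsWin p
lemma4p4 G even r0 p rp (i , on-r0) = Strategy.win r0 i G even p rp on-r0
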